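{- Let $G$ be the grid defined in the context. For every $m,n\ge0$ with $[G(m,n)]_3\ge1$, the base-3 representation of the integer $[G(m,n)]_3-1$ equals $G(r,s)$ for some $s\ge0$ and some $r\ge m-1$.
   Context: For a finite string $w=a_na_{n-1}\cdots a_0$ over digits $\{0,1,2\}$ let $[w]_{3/2}=\sum_k a_k(3/2)^k$ and $[w]_3=\sum_k a_k3^k$. Define an operation $T$ on such strings ("adding 2 in base $\frac32$"): if $w$ contains no digit $0$, first replace $w$ by $0w$; then change the rightmost $0$ of $w$ into $2$, change every digit to the right of it by $1\mapsto0$, $2\mapsto1$, and leave all digits to the left of it unchanged. Then $[T(w)]_{3/2}=[w]_{3/2}+2$. The grid $G$ has entries $G(i,j)$ (row $i$, column $j$, $i,j\ge0$): $G(0,j)$ is the binary representation of $j$, and $G(i+1,j)=T(G(i,j))$. Every string over $\{0,1,2\}$ not starting with $0$, and the string $0$, appears exactly once in $G$; in particular the ternary representation of every non-negative integer is some $G(r,s)$. -}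

module Defs where

open import Data.Nat using (ℕ; zero; suc; _+_; _*_)
open import Data.Nat.DivMod using (_/_; _%_)
open import Data.List using (List; []; _∷_)
open import Data.Bool using (Bool; true; false)
open import Induction.WellFounded using (Acc; acc)
open import Data.Nat.Induction using (<-wellFounded)
open import Data.Nat.DivMod using (m/n<m)
open import Relation.Binary.PropositionalEquality using (_≡_)

data Digit : Set where
  d0 d1 d2 : Digit

-- A string w = a_n a_{n-1} ... a_0 is stored LEAST significant digit first:
-- the list  a_0 ∷ a_1 ∷ ... ∷ a_n ∷ [].
Str : Set
Str = List Digit

digitVal : Digit → ℕ
digitVal d0 = 0
digitVal d1 = 1
digitVal d2 = 2

val3 : Str → ℕ
val3 []      = 0
val3 (a ∷ w) = digitVal a + 3 * val3 w

hasZero : Str → Bool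
hasZero []        = false
hasZero (d0 ∷ w)  = true
hasZero (d1 ∷ w)  = hasZero w
hasZero (d2 ∷ w)  = hasZero w

-- core step, for a string that contains a 0: the rightmost 0 (= first 0 in
-- our LSB-first list) becomes 2, digits to its right (earlier in the list)
-- map 1 ↦ 0, 2 ↦ 1, digits to its left are unchanged.
step : Str → Str
step []       = []
step (d0 ∷ w) = d2 ∷ w
step (d1 ∷ w) = d0 ∷ step w
step (d2 ∷ w) = d1 ∷ step w

-- prepend a leading 0 (i.e. append at the most significant end)
snoc0 : Str → Str
snoc0 []      = d0 ∷ []
snoc0 (a ∷ w) = a ∷ snoc0 w

-- the operation T ("adding 2 in base 3/2")
T : Str → Str
T w with hasZero w
... | true  = step w
... | false = step (snoc0 w)

toDigit : ℕ → Digit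
toDigit 0 = d0
toDigit 1 = d1
toDigit _ = d2

posDigits : (b : ℕ) → (n : ℕ) → Acc Data.Nat._<_ n → Str
posDigits b zero    _       = []
posDigits b (suc n) (acc rs) =
  toDigit (suc n % suc (suc b)) ∷
  posDigits b (suc n / suc (suc b)) (rs (m/n<m (suc n) (suc (suc b)) (Data.Nat.s≤s (Data.Nat.s≤s Data.Nat.z≤n))))

-- base-(k+2) representation of n
repr : (k : ℕ) → ℕ → Str
repr k zero    = d0 ∷ []
repr k (suc n) = posDigits k (suc n) (<-wellFounded (suc n))

binary : ℕ → Str
binary = repr 0

ternary : ℕ → Str
ternary = repr 1

G : ℕ → ℕ → Str
G zero    j = binary j
G (suc i) j = T (G i j)

module Submission where

open import Defs
open import Data.Nat using (ℕ; _≤_; _∸_)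
open import Data.Product using (Σ; _×_)
open import Relation.Binary.PropositionalEquality using (_≡_)

open import Data.Nat using (zero; suc; _+_; _*_; _<_; z≤n; s≤s; _%_; _/_; ⌊_/2⌋)
open import Data.Nat.Properties
open import Data.Nat.DivMod using ([m+kn]%n≡m%n; m<n⇒m%n≡m; +-distrib-/-∣ʳ; m<n⇒m/n≡0; m*n/n≡m)
open import Data.Nat.Divisibility using (divides-refl)
open import Data.Nat.Induction using (<-wellFounded)
open import Data.List using ([]; _∷_)
open import Data.List.Relation.Unary.All using (All; []; _∷_)
open import Data.Bool using (true; false)
open import Data.Product using (_,_; proj₁; proj₂)
open import Data.Sum using (_⊎_; inj₁; inj₂)
open import Data.Empty using (⊥-elim)
open import Induction.WellFounded using (Acc; acc)
open import Relation.Binary.PropositionalEquality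
  using (refl; sym; trans; cong; cong₂; _≢_; module ≡-Reasoning)

-- The proof rests on an explicit "row index" of a digit string
-- (least significant digit first):
--   row [] = 0,   row (a ∷ w) = ⌊ (a + 3 · row w) / 2 ⌋.
-- (1) T raises the row index by exactly one, so row (G m n) ≥ m.
-- (2) Subtracting 1 from a ternary numeral lowers the row index by at most
--     one, and deleting leading zeros changes neither value nor row index.
-- (3) Every canonical string (no leading zero, or the string 0) lies in row
--     `row u` of G.  By induction on the index: a string of index 0 is a
--     binary numeral, hence some G(0,j); a string of positive index
--     contains a 2 and has an explicit T-preimage of one smaller index.
-- (4) The base-b representation of [u]_b is u itself whenever u is
--     canonical with all digits < b.
-- For w = G m n with [w]₃ ≥ 1 let u be w - 1 (digitwise) with leading zeros
-- removed: by (4) u is the ternary representation of [w]₃ - 1, and by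
-- (1)-(3) it lies in row r = row u ≥ row w - 1 ≥ m - 1.

val : ℕ → Str → ℕ
val b []      = 0
val b (a ∷ w) = digitVal a + val b w * b

val3≡val-base3 : ∀ w → val3 w ≡ val 3 w
val3≡val-base3 []      = refl
val3≡val-base3 (a ∷ w) =
  cong (digitVal a +_) (trans (*-comm 3 (val3 w)) (cong (_* 3) (val3≡val-base3 w)))

DigitsBelow : ℕ → Str → Set
DigitsBelow b = All (λ a → digitVal a < b)

ternaryDigits : ∀ u → DigitsBelow 3 u
ternaryDigits []       = []
ternaryDigits (d0 ∷ w) = s≤s z≤n ∷ ternaryDigits w
ternaryDigits (d1 ∷ w) = s≤s (s≤s z≤n) ∷ ternaryDigits w
ternaryDigits (d2 ∷ w) = s≤s (s≤s (s≤s z≤n)) ∷ ternaryDigits w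

row : Str → ℕ
row []      = 0
row (a ∷ w) = ⌊ digitVal a + 3 * row w /2⌋

row-carry : ∀ a x → ⌊ digitVal a + 3 * suc x /2⌋ ≡ suc ⌊ suc (digitVal a + 3 * x) /2⌋
row-carry a x = cong ⌊_/2⌋ (begin
    d + 3 * suc x       ≡⟨ cong (d +_) (*-suc 3 x) ⟩
    d + (3 + 3 * x)     ≡⟨ sym (+-assoc d 3 (3 * x)) ⟩
    d + 3 + 3 * x       ≡⟨ cong (_+ 3 * x) (+-comm d 3) ⟩
    3 + d + 3 * x       ∎)
  where
  open ≡-Reasoning
  d = digitVal a

⌊suc/2⌋≤suc⌊/2⌋ : ∀ x → ⌊ suc x /2⌋ ≤ suc ⌊ x /2⌋
⌊suc/2⌋≤suc⌊/2⌋ x = ⌊n/2⌋-mono (n≤1+n (suc x))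

row-step : ∀ w → hasZero w ≡ true → row (step w) ≡ suc (row w)
row-step (d0 ∷ w) _ = refl
row-step (d1 ∷ w) z =
  trans (cong (λ r → ⌊ 3 * r /2⌋) (row-step w z)) (row-carry d0 (row w))
row-step (d2 ∷ w) z =
  trans (cong (λ r → ⌊ 1 + 3 * r /2⌋) (row-step w z)) (row-carry d1 (row w))

row-snoc0 : ∀ w → row (snoc0 w) ≡ row w
row-snoc0 []      = refl
row-snoc0 (a ∷ w) = cong (λ r → ⌊ digitVal a + 3 * r /2⌋) (row-snoc0 w)

hasZero-snoc0 : ∀ w → hasZero (snoc0 w) ≡ true
hasZero-snoc0 []       = refl
hasZero-snoc0 (d0 ∷ w) = refl
hasZero-snoc0 (d1 ∷ w) = hasZero-snoc0 w
hasZero-snoc0 (d2 ∷ w) = hasZero-snoc0 w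

row-T : ∀ w → row (T w) ≡ suc (row w)
row-T w with hasZero w in z
... | true  = row-step w z
... | false = trans (row-step (snoc0 w) (hasZero-snoc0 w)) (cong suc (row-snoc0 w))

row-G : ∀ m n → m ≤ row (G m n)
row-G zero    n = z≤n
row-G (suc m) n rewrite row-T (G m n) = s≤s (row-G m n)

-- Ternary decrement, meaningful for strings of positive value.
decr : Str → Str
decr []       = []
decr (d0 ∷ w) = d2 ∷ decr w
decr (d1 ∷ w) = d0 ∷ w
decr (d2 ∷ w) = d1 ∷ w

val-decr : ∀ w → 1 ≤ val3 w → suc (val3 (decr w)) ≡ val3 w
val-decr (d0 ∷ w) p
  rewrite sym (val-decr w (*-cancelˡ-< 3 0 (val3 w) p)) | *-suc 3 (val3 (decr w)) = refl
val-decr (d1 ∷ w) p = refl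
val-decr (d2 ∷ w) p = refl

row-decr : ∀ w → 1 ≤ val3 w → row w ≤ suc (row (decr w))
row-decr (d0 ∷ w) p = begin
    ⌊ 3 * row w /2⌋               ≤⟨ ⌊n/2⌋-mono (*-monoʳ-≤ 3 tail) ⟩
    ⌊ 3 * suc x /2⌋               ≡⟨ row-carry d0 x ⟩
    suc ⌊ 1 + 3 * x /2⌋           ≤⟨ s≤s (⌊n/2⌋-mono (n≤1+n _)) ⟩
    suc ⌊ 2 + 3 * x /2⌋           ∎
  where
  open ≤-Reasoning
  x = row (decr w)
  tail : row w ≤ suc x
  tail = row-decr w (*-cancelˡ-< 3 0 (val3 w) p)
row-decr (d1 ∷ w) p = ⌊suc/2⌋≤suc⌊/2⌋ (3 * row w)
row-decr (d2 ∷ w) p = s≤s (⌊n/2⌋-mono (n≤1+n _))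

data NoLeadingZero : Str → Set where
  empty : NoLeadingZero []
  last  : ∀ {a} → a ≢ d0 → NoLeadingZero (a ∷ [])
  more  : ∀ {a b w} → NoLeadingZero (b ∷ w) → NoLeadingZero (a ∷ b ∷ w)

-- The strings occurring in G: the string 0 and nonempty strings without
-- leading zero.
data Canonical : Str → Set where
  zero-string : Canonical (d0 ∷ [])
  positive    : ∀ {a w} → NoLeadingZero (a ∷ w) → Canonical (a ∷ w)

nlz-tail : ∀ {a w} → NoLeadingZero (a ∷ w) → NoLeadingZero w
nlz-tail (last _) = empty
nlz-tail (more p) = p

nlz-cons : ∀ {a x} → a ≢ d0 → NoLeadingZero x → NoLeadingZero (a ∷ x)
nlz-cons q empty    = last q
nlz-cons q (last p) = more (last p)
nlz-cons q (more p) = more (more p)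

cons₀ : Digit → Str → Str
cons₀ d0 [] = []
cons₀ a  x  = a ∷ x

stripZeros : Str → Str
stripZeros []      = []
stripZeros (a ∷ w) = cons₀ a (stripZeros w)

orZero : Str → Str
orZero []      = d0 ∷ []
orZero (a ∷ x) = a ∷ x

canonicalize : Str → Str
canonicalize w = orZero (stripZeros w)

nlz-cons₀ : ∀ a {x} → NoLeadingZero x → NoLeadingZero (cons₀ a x)
nlz-cons₀ d0 empty    = empty
nlz-cons₀ d0 (last p) = more (last p)
nlz-cons₀ d0 (more p) = more (more p)
nlz-cons₀ d1 p        = nlz-cons (λ ()) p
nlz-cons₀ d2 p        = nlz-cons (λ ()) p

nlz-stripZeros : ∀ w → NoLeadingZero (stripZeros w)
nlz-stripZeros []      = empty
nlz-stripZeros (a ∷ w) = nlz-cons₀ a (nlz-stripZeros w)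

canonical-orZero : ∀ {x} → NoLeadingZero x → Canonical (orZero x)
canonical-orZero empty    = zero-string
canonical-orZero (last q) = positive (last q)
canonical-orZero (more p) = positive (more p)

canonical-canonicalize : ∀ w → Canonical (canonicalize w)
canonical-canonicalize w = canonical-orZero (nlz-stripZeros w)

canonicalize-invariant : (f : Str → ℕ) → f (d0 ∷ []) ≡ f [] →
  (∀ a {w w′} → f w ≡ f w′ → f (a ∷ w) ≡ f (a ∷ w′)) →
  ∀ w → f (canonicalize w) ≡ f w
canonicalize-invariant f zero≡empty congruent w =
  trans (orZero-invariant (stripZeros w)) (strip-invariant w)
  where
  cons₀-invariant : ∀ a x → f (cons₀ a x) ≡ f (a ∷ x)
  cons₀-invariant d0 []      = sym zero≡empty
  cons₀-invariant d0 (b ∷ x) = refl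
  cons₀-invariant d1 x       = refl
  cons₀-invariant d2 x       = refl

  strip-invariant : ∀ w → f (stripZeros w) ≡ f w
  strip-invariant []      = refl
  strip-invariant (a ∷ w) =
    trans (cons₀-invariant a (stripZeros w)) (congruent a (strip-invariant w))

  orZero-invariant : ∀ x → f (orZero x) ≡ f x
  orZero-invariant []      = zero≡empty
  orZero-invariant (a ∷ x) = refl

val3-canonicalize : ∀ w → val3 (canonicalize w) ≡ val3 w
val3-canonicalize =
  canonicalize-invariant val3 refl (λ a eq → cong (λ v → digitVal a + 3 * v) eq)

row-canonicalize : ∀ w → row (canonicalize w) ≡ row w
row-canonicalize =
  canonicalize-invariant row refl (λ a eq → cong (λ r → ⌊ digitVal a + 3 * r /2⌋) eq)

val-positive : ∀ k {a w} → NoLeadingZero (a ∷ w) → 0 < val (2 + k) (a ∷ w)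
val-positive k {d1} (last _) = s≤s z≤n
val-positive k {d2} (last _) = s≤s z≤n
val-positive k {d0} (last q) = ⊥-elim (q refl)
val-positive k {a} {b ∷ w} (more p) =
  ≤-trans (m<n⇒m<n*o (2 + k) (val-positive k p)) (m≤n+m _ (digitVal a))

posDigits-val : ∀ k u → NoLeadingZero u → DigitsBelow (2 + k) u →
  ∀ n (rec : Acc _<_ n) → n ≡ val (2 + k) u → posDigits k n rec ≡ u
posDigits-val k []      p        al       zero    rec eq = refl
posDigits-val k (a ∷ w) p        al       zero    rec eq =
  ⊥-elim (<-irrefl eq (val-positive k p))
posDigits-val k (a ∷ w) p (a<b ∷ al) (suc n) (acc rs) eq =
  cong₂ _∷_ lowDigit (posDigits-val k w (nlz-tail p) al _ _ quotient)
  where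
  b = 2 + k
  v = val b w
  lowDigit : toDigit (suc n % b) ≡ a
  lowDigit = begin
    toDigit (suc n % b)                    ≡⟨ cong (λ m → toDigit (m % b)) eq ⟩
    toDigit ((digitVal a + v * b) % b)     ≡⟨ cong toDigit ([m+kn]%n≡m%n (digitVal a) v b) ⟩
    toDigit (digitVal a % b)               ≡⟨ cong toDigit (m<n⇒m%n≡m a<b) ⟩
    toDigit (digitVal a)                   ≡⟨ toDigit-digitVal a ⟩
    a                                      ∎
    where
    open ≡-Reasoning
    toDigit-digitVal : ∀ a → toDigit (digitVal a) ≡ a
    toDigit-digitVal d0 = refl
    toDigit-digitVal d1 = refl
    toDigit-digitVal d2 = refl
  quotient : suc n / b ≡ v
  quotient = begin
    suc n / b                              ≡⟨ cong (_/ b) eq ⟩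
    (digitVal a + v * b) / b               ≡⟨ +-distrib-/-∣ʳ (digitVal a) (divides-refl v) ⟩
    digitVal a / b + v * b / b             ≡⟨ cong₂ _+_ (m<n⇒m/n≡0 a<b) (m*n/n≡m v b) ⟩
    v                                      ∎
    where open ≡-Reasoning

repr-val : ∀ k {u} → Canonical u → DigitsBelow (2 + k) u → repr k (val (2 + k) u) ≡ u
repr-val k zero-string al = refl
repr-val k (positive {a} {w} p) al with val (2 + k) (a ∷ w) in eq
... | zero  = ⊥-elim (<-irrefl (sym eq) (val-positive k p))
... | suc n = posDigits-val k (a ∷ w) p al (suc n) (<-wellFounded (suc n)) (sym eq)

data HasTwo : Str → Set where
  here  : ∀ {w} → HasTwo (d2 ∷ w)
  there : ∀ {a w} → HasTwo w → HasTwo (a ∷ w)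

there⁻¹ : ∀ {a w} → a ≢ d2 → HasTwo (a ∷ w) → HasTwo w
there⁻¹ q here      = ⊥-elim (q refl)
there⁻¹ q (there h) = h

binaryOrHasTwo : ∀ u → DigitsBelow 2 u ⊎ HasTwo u
binaryOrHasTwo []       = inj₁ []
binaryOrHasTwo (d2 ∷ w) = inj₂ here
binaryOrHasTwo (d0 ∷ w) with binaryOrHasTwo w
... | inj₁ bin = inj₁ (s≤s z≤n ∷ bin)
... | inj₂ h   = inj₂ (there h)
binaryOrHasTwo (d1 ∷ w) with binaryOrHasTwo w
... | inj₁ bin = inj₁ (s≤s (s≤s z≤n) ∷ bin)
... | inj₂ h   = inj₂ (there h)

row-binary : ∀ {u} → DigitsBelow 2 u → row u ≡ 0
row-binary {[]}     []       = refl
row-binary {d0 ∷ w} (_ ∷ al) = cong (λ r → ⌊ 3 * r /2⌋) (row-binary al)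
row-binary {d1 ∷ w} (_ ∷ al) = cong (λ r → ⌊ 1 + 3 * r /2⌋) (row-binary al)
row-binary {d2 ∷ w} (s≤s (s≤s ()) ∷ _)

unstep : Str → Str
unstep []       = []
unstep (d0 ∷ w) = d1 ∷ unstep w
unstep (d1 ∷ w) = d2 ∷ unstep w
unstep (d2 ∷ w) = d0 ∷ w

step-unstep : ∀ {u} → HasTwo u → step (unstep u) ≡ u
step-unstep {d2 ∷ w} _ = refl
step-unstep {d0 ∷ w} h = cong (d0 ∷_) (step-unstep (there⁻¹ (λ ()) h))
step-unstep {d1 ∷ w} h = cong (d1 ∷_) (step-unstep (there⁻¹ (λ ()) h))

hasZero-unstep : ∀ {u} → HasTwo u → hasZero (unstep u) ≡ true
hasZero-unstep {d2 ∷ w} _ = refl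
hasZero-unstep {d0 ∷ w} h = hasZero-unstep (there⁻¹ (λ ()) h)
hasZero-unstep {d1 ∷ w} h = hasZero-unstep (there⁻¹ (λ ()) h)

-- Inverse of T: like unstep, but a most significant 2 turning into 0 is
-- dropped (it was the 0 prepended by T).
unT : Str → Str
unT []           = []
unT (d0 ∷ w)     = d1 ∷ unT w
unT (d1 ∷ w)     = d2 ∷ unT w
unT (d2 ∷ [])    = []
unT (d2 ∷ b ∷ w) = d0 ∷ b ∷ w

-- unT agrees with unstep, except when it drops the leading 0, in which case
-- the result has no 0 (so T prepends one again).
unT-cases : ∀ {u} → HasTwo u →
  (unT u ≡ unstep u) ⊎ ((unstep u ≡ snoc0 (unT u)) × (hasZero (unT u) ≡ false))
unT-cases {d2 ∷ []}    _ = inj₂ (refl , refl)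
unT-cases {d2 ∷ b ∷ w} _ = inj₁ refl
unT-cases {d0 ∷ w} h with unT-cases (there⁻¹ (λ ()) h)
... | inj₁ e       = inj₁ (cong (d1 ∷_) e)
... | inj₂ (e , z) = inj₂ (cong (d1 ∷_) e , z)
unT-cases {d1 ∷ w} h with unT-cases (there⁻¹ (λ ()) h)
... | inj₁ e       = inj₁ (cong (d2 ∷_) e)
... | inj₂ (e , z) = inj₂ (cong (d2 ∷_) e , z)

T-unT : ∀ {u} → HasTwo u → T (unT u) ≡ u
T-unT {u} h with unT-cases h
... | inj₁ e rewrite e | hasZero-unstep h = step-unstep h
... | inj₂ (e , z) rewrite z = trans (cong step (sym e)) (step-unstep h)

row-unT : ∀ {u} → HasTwo u → suc (row (unT u)) ≡ row u
row-unT {u} h = begin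
  suc (row (unT u))   ≡⟨ sym (row-T (unT u)) ⟩
  row (T (unT u))     ≡⟨ cong row (T-unT h) ⟩
  row u               ∎
  where open ≡-Reasoning

nlz-unT : ∀ {u} → HasTwo u → NoLeadingZero u → NoLeadingZero (unT u)
nlz-unT {d2 ∷ []}    _ _        = empty
nlz-unT {d2 ∷ b ∷ w} _ (more p) = more p
nlz-unT {d0 ∷ w} h p = nlz-cons (λ ()) (nlz-unT (there⁻¹ (λ ()) h) (nlz-tail p))
nlz-unT {d1 ∷ w} h p = nlz-cons (λ ()) (nlz-unT (there⁻¹ (λ ()) h) (nlz-tail p))

-- The T-preimage of a canonical string containing a 2, itself canonical
-- (the preimage of the string 2 is the string 0).
predT : Str → Str
predT u = orZero (unT u)

T-predT : ∀ {u} → HasTwo u → T (predT u) ≡ u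
T-predT {d2 ∷ []}    _ = refl
T-predT {d2 ∷ b ∷ w} h = T-unT h
T-predT {d0 ∷ w}     h = T-unT h
T-predT {d1 ∷ w}     h = T-unT h

row-predT : ∀ {u} → HasTwo u → suc (row (predT u)) ≡ row u
row-predT {d2 ∷ []}    _ = refl
row-predT {d2 ∷ b ∷ w} h = row-unT h
row-predT {d0 ∷ w}     h = row-unT h
row-predT {d1 ∷ w}     h = row-unT h

canonical-predT : ∀ {u} → HasTwo u → Canonical u → Canonical (predT u)
canonical-predT (there ()) zero-string
canonical-predT h (positive p) = canonical-orZero (nlz-unT h p)

occurs-in-row : ∀ k {u} → Canonical u → row u ≡ k → Σ ℕ (λ s → G k s ≡ u)
occurs-in-row zero {u} c r with binaryOrHasTwo u
... | inj₁ bin = val 2 u , repr-val 0 c bin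
... | inj₂ h   = ⊥-elim (1+n≢0 (trans (row-predT h) r))
occurs-in-row (suc k) {u} c r with binaryOrHasTwo u
... | inj₁ bin = ⊥-elim (0≢1+n (trans (sym (row-binary bin)) r))
... | inj₂ h with occurs-in-row k (canonical-predT h c) (suc-injective (trans (row-predT h) r))
...   | s , g = s , trans (cong T g) (T-predT h)

lemma8 : (m n : ℕ) → 1 ≤ val3 (G m n) →
    Σ ℕ (λ r → Σ ℕ (λ s → (m ∸ 1 ≤ r) × (ternary (val3 (G m n) ∸ 1) ≡ G r s)))
lemma8 m n positiveValue = row u , s , rowBound , representation
  where
  w = G m n
  u = canonicalize (decr w)
  canonical-u = canonical-canonicalize (decr w)
  located = occurs-in-row (row u) canonical-u refl
  s = proj₁ located

  rowBound : m ∸ 1 ≤ row u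
  rowBound rewrite row-canonicalize (decr w) =
    ∸-monoˡ-≤ 1 (≤-trans (row-G m n) (row-decr w positiveValue))

  representation : ternary (val3 w ∸ 1) ≡ G (row u) s
  representation = begin
    ternary (val3 w ∸ 1)                 ≡⟨ cong (λ v → ternary (v ∸ 1)) (sym (val-decr w positiveValue)) ⟩
    ternary (val3 (decr w))              ≡⟨ cong ternary (sym (val3-canonicalize (decr w))) ⟩
    ternary (val3 u)                     ≡⟨ cong ternary (val3≡val-base3 u) ⟩
    repr 1 (val 3 u)                     ≡⟨ repr-val 1 canonical-u (ternaryDigits u) ⟩
    u                                    ≡⟨ sym (proj₂ located) ⟩
    G (row u) s                          ∎
    where open ≡-Reasoning
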